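{- Let $w$ be a word in the generators $s_{p,q}$ of $J_n$, representing a cactus $c\in J_n$. Consider the following procedure. If $w = u\,x\,v\,y\,z$ with $x,y$ single letters and subwords $u,v,z$, such that the letter $y$ can be moved leftwards across the letters of $v$, one adjacent letter at a time, using only elementary moves of the following types: $ab\leftrightarrow ba$ when $a=s_{p,q}$, $b=s_{m,r}$ with $[p,q]\cap[m,r]=\emptyset$; $s_{p,q}s_{m,r}\leftrightarrow s_{p+q-r,p+q-m}s_{p,q}$ when $[m,r]\subset[p,q]$ (these moves may change both letters involved), and so that the moved letter arrives next to $x$ equal to $x$ (i.e. $vy$ is transformed into $x v'$), then replace $w$ by $u\,v'\,z$ (annihilating $xx$ by $s_{p,q}^2=1$). Repeat as long as possible. Then the result of this procedure is the empty word if and only if $c$ is trivial in $J_n$.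
   Context: For $n \ge 2$, the cactus group $J_n$ is the group with generators $s_{p,q}$ for $1 \le p < q \le n$ and relations: (j1) $s_{p,q}^2 = 1$; (j2) $s_{p,q}s_{m,r} = s_{m,r}s_{p,q}$ whenever $[p,q]\cap[m,r]=\emptyset$; (j3) $s_{p,q}s_{m,r} = s_{p+q-r,\,p+q-m}\,s_{p,q}$ whenever $[m,r]\subset[p,q]$ (intervals of integers). -}

module Defs where

open import Data.Nat using (ℕ; _+_; _∸_; _≤_; _<_)
open import Data.List using (List; []; _∷_; _++_; [_])
open import Data.Product using (_×_; Σ; ∃)
open import Data.Sum using (_⊎_)
open import Relation.Binary.PropositionalEquality using (_≡_)
open import Relation.Nullary using (¬_)
open import Relation.Binary.Construct.Closure.Equivalence using (EqClosure)

record Gen (n : ℕ) : Set where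
  constructor s
  field
    p q : ℕ
    .1≤p : 1 ≤ p
    .p<q : p < q
    .q≤n : q ≤ n
open Gen public

Word : ℕ → Set
Word n = List (Gen n)

Disjoint : ∀ {n} → Gen n → Gen n → Set
Disjoint a b = (q a < p b) ⊎ (q b < p a)

Inside : ∀ {n} → Gen n → Gen n → Set
Inside b a = (p a ≤ p b) × (q b ≤ q a)

FlipOf : ∀ {n} → Gen n → Gen n → Gen n → Set
FlipOf a b c = (p c ≡ p a + q a ∸ q b) × (q c ≡ p a + q a ∸ p b)

-- Elementary move  a b ↦ c d  (the right letter moves to the left, becoming c).
data Move {n : ℕ} : Gen n → Gen n → Gen n → Gen n → Set where
  comm  : ∀ {a b} → Disjoint a b → Move a b b a
  nestF : ∀ {a b c} → Inside b a → FlipOf a b c → Move a b c a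
  -- reverse of nestF:  s_{p+q-r,p+q-m} s_{p,q} ↦ s_{p,q} s_{m,r}
  nestB : ∀ {a b d} → Inside d b → FlipOf b d a → Move a b b d

-- Slide v y y' v' : the word v y is transformed into y' v' by moving the
-- letter y leftwards across v one adjacent letter at a time.
data Slide {n : ℕ} : Word n → Gen n → Gen n → Word n → Set where
  here  : ∀ {y} → Slide [] y y []
  there : ∀ {b v₀ y y₁ v₁ y₂ b'} →
          Slide v₀ y y₁ v₁ → Move b y₁ y₂ b' →
          Slide (b ∷ v₀) y y₂ (b' ∷ v₁)

data Step {n : ℕ} : Word n → Word n → Set where
  step : ∀ u x v y z v' → Slide v y x v' →
         Step (u ++ x ∷ v ++ y ∷ z) (u ++ v' ++ z)

Irreducible : ∀ {n} → Word n → Set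
Irreducible w = ∀ w' → ¬ Step w w'

data Rel {n : ℕ} : Word n → Word n → Set where
  j1 : ∀ a → Rel (a ∷ a ∷ []) []
  j2 : ∀ {a b} → Disjoint a b → Rel (a ∷ b ∷ []) (b ∷ a ∷ [])
  j3 : ∀ {a b c} → Inside b a → FlipOf a b c → Rel (a ∷ b ∷ []) (c ∷ a ∷ [])

data RelCtx {n : ℕ} : Word n → Word n → Set where
  ctx : ∀ u l r v → Rel l r → RelCtx (u ++ l ++ v) (u ++ r ++ v)

_≈J_ : ∀ {n} → Word n → Word n → Set
_≈J_ = EqClosure RelCtx

IsTrivial : ∀ {n} → Word n → Set
IsTrivial w = w ≈J []

{-# OPTIONS --safe #-}
-- Let J_n act on pairs (τ, r): τ is the arrangement of the points 1..n produced by
-- the interval reversals ρ_{p,q} of the letters read so far, and r is an element of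
-- the right-angled Coxeter group generated by the subsets of {1..n}, two subsets
-- commuting when they are disjoint or nested.  The letter s_{p,q} sends (τ, r) to
-- (ρ_{p,q} τ, r · τ⁻¹[p,q]).  The relations j1–j3 act trivially and every step of the
-- procedure is a consequence of them, so the procedure preserves the element of J_n.
-- Conversely, in an irreducible word no block τ⁻¹[p,q] ever cancels: the block of a
-- new letter g could only cancel an equal earlier block, of a letter x, commuting
-- with all blocks in between; since τ is a bijection, commuting blocks are exactly
-- those of letters admitting an elementary move, so g would slide back onto x, which
-- is a step of the procedure.  Hence the Coxeter element of an irreducible word is
-- its word of blocks, which is empty only for the empty word.
module Submission where

open import Data.Nat
open import Data.Nat.Properties
open import Data.Nat.Tactic.RingSolver using (solve-∀)
open import Data.Bool using (true; if_then_else_)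
import Data.Bool as Bool
open import Data.Empty using (⊥-elim)
open import Data.Fin using (Fin; toℕ; fromℕ<)
open import Data.Fin.Properties using (toℕ-fromℕ<)
open import Data.Fin.Subset using (Subset; _⊆_; _∩_; Empty; Nonempty) renaming (_∈_ to _∈ˢ_)
open import Data.Fin.Subset.Properties using (nonempty?; _⊆?_; ∩-comm; x∈p∩q⁺; x∈p∩q⁻)
open import Data.List using (List; []; _∷_; _++_; [_]; _∷ʳ_; filter)
open import Data.List.Properties
  using (++-assoc; ++-identityʳ; ++-conicalʳ; ∷-injective; ∷-injectiveʳ; ∷ʳ-injective;
         filter-++; filter-accept; filter-reject; filter-none)
open import Data.List.Relation.Unary.All as All using (All; []; _∷_; all?)
open import Data.List.Relation.Unary.All.Properties using (++⁻ˡ; ++⁻ʳ; ++⁺)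
open import Data.List.Relation.Unary.Any using (here; there)
open import Data.List.Membership.Propositional using (_∈_)
open import Data.List.Membership.Propositional.Properties using (∈-++⁺ʳ; ∈-filter⁺; ∈-filter⁻)
open import Data.Product using (_×_; _,_; proj₁; proj₂; ∃; ∃₂)
open import Data.Sum using (_⊎_; inj₁; inj₂; [_,_]′; swap)
open import Data.Unit using (⊤; tt)
open import Data.Vec using (tabulate)
open import Data.Vec.Properties using (lookup∘tabulate; tabulate-cong; []=⇒lookup; lookup⇒[]=; ≡-dec)
open import Function using (_∘_; id)
open import Function.Bundles using (_⇔_; mk⇔; Equivalence)
open import Relation.Binary.Definitions using (DecidableEquality; Decidable; Symmetric)
open import Relation.Binary.PropositionalEquality hiding ([_])
open import Relation.Binary.Construct.Closure.ReflexiveTransitive using (Star; ε; _◅_; _◅◅_)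
open import Relation.Binary.Construct.Closure.Symmetric using (SymClosure; fwd; bwd)
import Relation.Binary.Construct.Closure.Equivalence as EqClosure
open import Relation.Nullary using (¬_; ¬?; Dec; yes; no; does; contradiction; recompute)
open import Relation.Nullary.Decidable using (_×-dec_; _⊎-dec_; dec-true; dec-false; does-⇔)
open import Relation.Unary using () renaming (Decidable to Decidable₁)

module Reflection where

  private variable p q m r x y : ℕ

  infix 4 _∈[_,_] _∉[_,_] _∈[_,_]?

  _∈[_,_] : ℕ → ℕ → ℕ → Set
  y ∈[ p , q ] = p ≤ y × y ≤ q

  _∉[_,_] : ℕ → ℕ → ℕ → Set
  y ∉[ p , q ] = ¬ y ∈[ p , q ]

  _∈[_,_]? : ∀ y p q → Dec (y ∈[ p , q ])
  y ∈[ p , q ]? = p ≤? y ×-dec y ≤? q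

  reflect : ℕ → ℕ → ℕ → ℕ
  reflect p q y = if does (y ∈[ p , q ]?) then p + q ∸ y else y

  ≤∸-swap : y ≤ p → x ≤ p ∸ y → y ≤ p ∸ x
  ≤∸-swap {y} {p} {x} y≤p x≤p∸y =
    m+n≤o⇒m≤o∸n y (subst (_≤ p) (+-comm x y) (m≤o∸n⇒m+n≤o x y≤p x≤p∸y))

  ∸≤-swap : y ≤ p → p ∸ y ≤ x → p ∸ x ≤ y
  ∸≤-swap {y} {p} {x} y≤p p∸y≤x =
    m≤n+o⇒m∸n≤o p x (subst (_≤ x + y) (m∸n+n≡m y≤p) (+-monoˡ-≤ y p∸y≤x))

  ∈[]⇒≤+ : y ∈[ p , q ] → y ≤ p + q
  ∈[]⇒≤+ {p = p} {q = q} (_ , y≤q) = ≤-trans y≤q (m≤n+m q p)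

  mirror-∈ : y ∈[ p , q ] → p + q ∸ y ∈[ p , q ]
  mirror-∈ {y} {p} {q} (p≤y , y≤q) =
      subst (_≤ p + q ∸ y) (m+n∸n≡m p q) (∸-monoʳ-≤ (p + q) y≤q)
    , subst (p + q ∸ y ≤_) (m+n∸m≡n p q) (∸-monoʳ-≤ (p + q) p≤y)

  reflect-inside : y ∈[ p , q ] → reflect p q y ≡ p + q ∸ y
  reflect-inside {y} {p} {q} y∈ =
    cong (λ b → if b then p + q ∸ y else y) (dec-true (y ∈[ p , q ]?) y∈)

  reflect-outside : y ∉[ p , q ] → reflect p q y ≡ y
  reflect-outside {y} {p} {q} y∉ =
    cong (λ b → if b then p + q ∸ y else y) (dec-false (y ∈[ p , q ]?) y∉)

  reflect-∈ : y ∈[ p , q ] → reflect p q y ∈[ p , q ]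
  reflect-∈ y∈ = subst (_∈[ _ , _ ]) (sym (reflect-inside y∈)) (mirror-∈ y∈)

  reflect-involutive : ∀ p q y → reflect p q (reflect p q y) ≡ y
  reflect-involutive p q y with y ∈[ p , q ]?
  ... | yes y∈ = begin
    reflect p q (reflect p q y) ≡⟨ cong (reflect p q) (reflect-inside y∈) ⟩
    reflect p q (p + q ∸ y)     ≡⟨ reflect-inside (mirror-∈ y∈) ⟩
    p + q ∸ (p + q ∸ y)         ≡⟨ m∸[m∸n]≡n (∈[]⇒≤+ y∈) ⟩
    y                           ∎
    where open ≡-Reasoning
  ... | no y∉ = trans (cong (reflect p q) (reflect-outside y∉)) (reflect-outside y∉)

  reflect-preserves : (P : ℕ → Set) →
    (∀ {x} → x ∈[ p , q ] → P x) ⊎ (∀ {x} → x ∈[ p , q ] → ¬ P x) →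
    ∀ y → P (reflect p q y) ⇔ P y
  reflect-preserves {p} {q} P constant y with y ∈[ p , q ]? | constant
  ... | yes y∈ | inj₁ all = mk⇔ (λ _ → all y∈) (λ _ → all (reflect-∈ y∈))
  ... | yes y∈ | inj₂ none = mk⇔ (⊥-elim ∘ none (reflect-∈ y∈)) (⊥-elim ∘ none y∈)
  ... | no y∉ | _ = subst (λ x → P x ⇔ P y) (sym (reflect-outside y∉)) (mk⇔ id id)

  reflect-comm : (∀ {x} → x ∈[ p , q ] → x ∉[ m , r ]) →
    ∀ y → reflect p q (reflect m r y) ≡ reflect m r (reflect p q y)
  reflect-comm {p} {q} {m} {r} disjoint y with y ∈[ m , r ]?
  ... | yes y∈ = trans (reflect-outside (disjoint′ (reflect-∈ y∈)))
                       (sym (cong (reflect m r) (reflect-outside (disjoint′ y∈))))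
    where
    disjoint′ : ∀ {x} → x ∈[ m , r ] → x ∉[ p , q ]
    disjoint′ x∈ x∈′ = disjoint x∈′ x∈
  ... | no y∉ = trans (cong (reflect p q) (reflect-outside y∉)) (sym (reflect-outside ρy∉))
    where
    ρy∉ : reflect p q y ∉[ m , r ]
    ρy∉ = y∉ ∘ Equivalence.to (reflect-preserves (_∈[ m , r ]) (inj₂ disjoint) y)

  private
    -- the truncated subtractions of `reflect-conjugate`, each given as a sum
    ∸-conjugate : ∀ {P y z m r m′ r′} → z + y ≡ P → m′ + r ≡ P → r′ + m ≡ P →
                  z ≤ m + r → y ≤ m′ + r′ → m + r ∸ z ≡ P ∸ (m′ + r′ ∸ y)
    ∸-conjugate {P} {y} {z} {m} {r} {m′} {r′} z+y≡P m′+r≡P r′+m≡P z≤ y≤ =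
      trans (sym (m+n∸m≡n u w)) (cong (_∸ u) u+w≡P)
      where
      u = m′ + r′ ∸ y
      w = m + r ∸ z
      interchange : ∀ a b c d → (a + b) + (c + d) ≡ (a + c) + (b + d)
      interchange = solve-∀
      u+w≡P : u + w ≡ P
      u+w≡P = +-cancelʳ-≡ (y + z) (u + w) P (begin
        (u + w) + (y + z)     ≡⟨ interchange u w y z ⟩
        (u + y) + (w + z)     ≡⟨ cong₂ _+_ (m∸n+n≡m y≤) (m∸n+n≡m z≤) ⟩
        (m′ + r′) + (m + r)   ≡⟨ cong (m′ + r′ +_) (+-comm m r) ⟩
        (m′ + r′) + (r + m)   ≡⟨ interchange m′ r′ r m ⟩
        (m′ + r) + (r′ + m)   ≡⟨ cong₂ _+_ m′+r≡P r′+m≡P ⟩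
        P + P                 ≡⟨ cong (P +_) (trans (sym z+y≡P) (+-comm z y)) ⟩
        P + (y + z)           ∎)
        where open ≡-Reasoning

  module Nested {p q m r} (p≤m : p ≤ m) (m≤r : m ≤ r) (r≤q : r ≤ q) where

    -- the mirror image of [m, r] in [p, q]
    m′ r′ : ℕ
    m′ = p + q ∸ r
    r′ = p + q ∸ m

    private
      r≤p+q : r ≤ p + q
      r≤p+q = ≤-trans r≤q (m≤n+m q p)

      m≤p+q : m ≤ p + q
      m≤p+q = ≤-trans m≤r r≤p+q

    inner-⊆ : x ∈[ m , r ] → x ∈[ p , q ]
    inner-⊆ (m≤x , x≤r) = ≤-trans p≤m m≤x , ≤-trans x≤r r≤q

    flipped-⊆ : x ∈[ m′ , r′ ] → x ∈[ p , q ]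
    flipped-⊆ (m′≤x , x≤r′) = ≤-trans (proj₁ (mirror-∈ (p≤r , r≤q))) m′≤x
                            , ≤-trans x≤r′ (proj₂ (mirror-∈ (p≤m , ≤-trans m≤r r≤q)))
      where p≤r = ≤-trans p≤m m≤r

    mirror-∈-nested : y ∈[ p , q ] → (p + q ∸ y ∈[ m , r ] ⇔ y ∈[ m′ , r′ ])
    mirror-∈-nested y∈ = mk⇔
      (λ (m≤ , ≤r) → ∸≤-swap y≤p+q ≤r , ≤∸-swap y≤p+q m≤)
      (λ (m′≤ , ≤r′) → ≤∸-swap m≤p+q ≤r′ , ∸≤-swap r≤p+q m′≤)
      where y≤p+q = ∈[]⇒≤+ y∈

    reflect-∈-nested : ∀ y → reflect p q y ∈[ m , r ] ⇔ y ∈[ m′ , r′ ]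
    reflect-∈-nested y with y ∈[ p , q ]?
    ... | yes y∈ = subst (λ x → x ∈[ m , r ] ⇔ y ∈[ m′ , r′ ]) (sym (reflect-inside y∈))
                         (mirror-∈-nested y∈)
    ... | no y∉ = subst (λ x → x ∈[ m , r ] ⇔ y ∈[ m′ , r′ ]) (sym (reflect-outside y∉))
                        (mk⇔ (⊥-elim ∘ y∉ ∘ inner-⊆) (⊥-elim ∘ y∉ ∘ flipped-⊆))

    reflect-conjugate : ∀ y → reflect m r (reflect p q y) ≡ reflect p q (reflect m′ r′ y)
    reflect-conjugate y with y ∈[ p , q ]?
    ... | no y∉ = begin
      reflect m r (reflect p q y)    ≡⟨ cong (reflect m r) (reflect-outside y∉) ⟩
      reflect m r y                  ≡⟨ reflect-outside (y∉ ∘ inner-⊆) ⟩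
      y                              ≡⟨ reflect-outside y∉ ⟨
      reflect p q y                  ≡⟨ cong (reflect p q) (reflect-outside (y∉ ∘ flipped-⊆)) ⟨
      reflect p q (reflect m′ r′ y)  ∎
      where open ≡-Reasoning
    ... | yes y∈ with p + q ∸ y ∈[ m , r ]?
    ...   | no z∉ = begin
      reflect m r (reflect p q y)    ≡⟨ cong (reflect m r) (reflect-inside y∈) ⟩
      reflect m r (p + q ∸ y)        ≡⟨ reflect-outside z∉ ⟩
      p + q ∸ y                      ≡⟨ reflect-inside y∈ ⟨
      reflect p q y                  ≡⟨ cong (reflect p q) (reflect-outside y∉′) ⟨
      reflect p q (reflect m′ r′ y)  ∎
      where
      open ≡-Reasoning
      y∉′ = z∉ ∘ Equivalence.from (mirror-∈-nested y∈)
    ...   | yes z∈ = begin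
      reflect m r (reflect p q y)    ≡⟨ cong (reflect m r) (reflect-inside y∈) ⟩
      reflect m r (p + q ∸ y)        ≡⟨ reflect-inside z∈ ⟩
      m + r ∸ (p + q ∸ y)            ≡⟨ ∸-conjugate {m = m} {r} {m′} {r′}
                                          (m∸n+n≡m (∈[]⇒≤+ y∈)) (m∸n+n≡m r≤p+q) (m∸n+n≡m m≤p+q)
                                          (≤-trans (proj₂ z∈) (m≤n+m r m))
                                          (≤-trans (proj₂ y∈′) (m≤n+m r′ m′)) ⟩
      p + q ∸ (m′ + r′ ∸ y)          ≡⟨ reflect-inside (flipped-⊆ (mirror-∈ y∈′)) ⟨
      reflect p q (m′ + r′ ∸ y)      ≡⟨ cong (reflect p q) (reflect-inside y∈′) ⟨
      reflect p q (reflect m′ r′ y)  ∎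
      where
      open ≡-Reasoning
      y∈′ = Equivalence.to (mirror-∈-nested y∈) z∈
module _ {A : Set} where

  private variable x y : A

  ∷ʳ-last-∈ : ∀ (xs ys : List A) {zs} → y ∈ zs → xs ∷ʳ x ≡ ys ++ zs → x ∈ zs
  ∷ʳ-last-∈ {x = x} xs [] _ eq = subst (x ∈_) eq (∈-++⁺ʳ xs (here refl))
  ∷ʳ-last-∈ {y = y} [] (_ ∷ ys) y∈zs eq =
    contradiction (subst (y ∈_) (++-conicalʳ ys _ (sym (∷-injectiveʳ eq))) y∈zs) λ ()
  ∷ʳ-last-∈ (_ ∷ xs) (_ ∷ ys) y∈zs eq = ∷ʳ-last-∈ xs ys y∈zs (∷-injectiveʳ eq)

  ++-split : ∀ (a b c : List A) d → a ++ b ≡ c ++ x ∷ d →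
    (∃ λ e → a ≡ c ++ x ∷ e × d ≡ e ++ b) ⊎ (∃ λ e → c ≡ a ++ e × b ≡ e ++ x ∷ d)
  ++-split [] b c d eq = inj₂ (c , refl , eq)
  ++-split (y ∷ a) b [] d eq with refl , eq′ ← ∷-injective eq =
    inj₁ (a , refl , sym eq′)
  ++-split (y ∷ a) b (_ ∷ c) d eq with refl , eq′ ← ∷-injective eq
                                   with ++-split a b c d eq′
  ... | inj₁ (e , a≡ , d≡) = inj₁ (e , cong (y ∷_) a≡ , d≡)
  ... | inj₂ (e , c≡ , b≡) = inj₂ (e , cong (y ∷_) c≡ , b≡)

  last-occurrence : DecidableEquality A → ∀ x (r : List A) →
    (∃₂ λ α β → r ≡ α ++ x ∷ β × All (_≢ x) β) ⊎ All (_≢ x) r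
  last-occurrence _≟_ x [] = inj₂ []
  last-occurrence _≟_ x (y ∷ r) with last-occurrence _≟_ x r
  ... | inj₁ (α , β , refl , x∉β) = inj₁ (y ∷ α , β , refl , x∉β)
  ... | inj₂ x∉r with y ≟ x
  ...   | yes refl = inj₁ ([] , r , refl , x∉r)
  ...   | no y≢x = inj₂ (y≢x ∷ x∉r)

module RightAngledCoxeter {A : Set} (_≟_ : DecidableEquality A)
  (_⌣_ : A → A → Set) (_⌣?_ : Decidable _⌣_) (⌣-sym : Symmetric _⌣_) where

  private variable S T U V x y : A ; r r′ α β : List A

  Dependent : A → A → Set
  Dependent U V = U ≡ V ⊎ ¬ U ⌣ V

  OneOf : A → A → A → Set
  OneOf U V x = x ≡ U ⊎ x ≡ V

  oneOf? : ∀ U V → Decidable₁ (OneOf U V)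
  oneOf? U V x = x ≟ U ⊎-dec x ≟ V

  project : A → A → List A → List A
  project U V = filter (oneOf? U V)

  infix 4 _≃_
  record _≃_ (r r′ : List A) : Set where
    constructor mk≃
    field project-≡ : ∀ U V → Dependent U V → project U V r ≡ project U V r′

  ≃-refl : r ≃ r
  ≃-refl = mk≃ λ _ _ _ → refl

  ≃-sym : r ≃ r′ → r′ ≃ r
  ≃-sym (mk≃ eq) = mk≃ λ U V d → sym (eq U V d)

  ≃-trans : ∀ {r r′ r″} → r ≃ r′ → r′ ≃ r″ → r ≃ r″
  ≃-trans (mk≃ eq) (mk≃ eq′) = mk≃ λ U V d → trans (eq U V d) (eq′ U V d)

  ≃-[] : r ≃ [] → r ≡ []
  ≃-[] {[]} _ = refl
  ≃-[] {x ∷ r} (mk≃ eq)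
    with () ← trans (sym (filter-accept (oneOf? x x) (inj₁ refl))) (eq x x (inj₁ refl))

  commuting-not-OneOf : Dependent U V → OneOf U V S → S ⌣ y → y ≢ S → ¬ OneOf U V y
  commuting-not-OneOf _ (inj₁ refl) _ y≢S (inj₁ refl) = y≢S refl
  commuting-not-OneOf _ (inj₂ refl) _ y≢S (inj₂ refl) = y≢S refl
  commuting-not-OneOf (inj₁ refl) (inj₁ refl) _ y≢S (inj₂ refl) = y≢S refl
  commuting-not-OneOf (inj₁ refl) (inj₂ refl) _ y≢S (inj₁ refl) = y≢S refl
  commuting-not-OneOf (inj₂ U⌣̸V) (inj₁ refl) S⌣y _ (inj₂ refl) = U⌣̸V S⌣y
  commuting-not-OneOf (inj₂ U⌣̸V) (inj₂ refl) S⌣y _ (inj₁ refl) = U⌣̸V (⌣-sym S⌣y)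

  project-delete : ∀ α β → ¬ OneOf U V S → project U V (α ++ S ∷ β) ≡ project U V (α ++ β)
  project-delete {U} {V} {S} α β S∉ = begin
    project U V (α ++ S ∷ β)             ≡⟨ filter-++ (oneOf? U V) α (S ∷ β) ⟩
    project U V α ++ project U V (S ∷ β) ≡⟨ cong (project U V α ++_) (filter-reject (oneOf? U V) S∉) ⟩
    project U V α ++ project U V β       ≡⟨ filter-++ (oneOf? U V) α β ⟨
    project U V (α ++ β)                 ∎
    where open ≡-Reasoning

  project-descent : ∀ α β → Dependent U V → OneOf U V S → All (S ⌣_) β → All (_≢ S) β →
                    project U V (α ++ S ∷ β) ≡ project U V (α ++ β) ∷ʳ S
  project-descent {U} {V} {S} α β d S∈ S⌣β S∉β = begin
    project U V (α ++ S ∷ β)              ≡⟨ filter-++ (oneOf? U V) α (S ∷ β) ⟩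
    project U V α ++ project U V (S ∷ β)  ≡⟨ cong (project U V α ++_) (filter-accept (oneOf? U V) S∈) ⟩
    project U V α ++ S ∷ project U V β    ≡⟨ cong (λ t → project U V α ++ S ∷ t) β-invisible ⟩
    project U V α ++ [ S ]                ≡⟨ cong (_∷ʳ S) (++-identityʳ _) ⟨
    (project U V α ++ []) ∷ʳ S            ≡⟨ cong (λ t → (project U V α ++ t) ∷ʳ S) β-invisible ⟨
    (project U V α ++ project U V β) ∷ʳ S ≡⟨ cong (_∷ʳ S) (filter-++ (oneOf? U V) α β) ⟨
    project U V (α ++ β) ∷ʳ S             ∎
    where
    open ≡-Reasoning
    invisible : ∀ {β} → All (S ⌣_) β → All (_≢ S) β → All (¬_ ∘ OneOf U V) β
    invisible [] [] = []
    invisible (S⌣y ∷ S⌣β) (y≢S ∷ S∉β) =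
      commuting-not-OneOf d S∈ S⌣y y≢S ∷ invisible S⌣β S∉β
    β-invisible : project U V β ≡ []
    β-invisible = filter-none (oneOf? U V) (invisible S⌣β S∉β)

  project-∷ʳ-in : ∀ r → Dependent U V → OneOf U V S → project U V (r ∷ʳ S) ≡ project U V r ∷ʳ S
  project-∷ʳ-in {U} {V} r d S∈ =
    trans (project-descent r [] d S∈ [] []) (cong (λ t → project U V t ∷ʳ _) (++-identityʳ r))

  project-∷ʳ-out : ∀ r → ¬ OneOf U V S → project U V (r ∷ʳ S) ≡ project U V r
  project-∷ʳ-out {U} {V} r S∉ =
    trans (project-delete r [] S∉) (cong (project U V) (++-identityʳ r))

  RightDescent : A → List A → Set
  RightDescent S r = ∃₂ λ α β → r ≡ α ++ S ∷ β × All (S ⌣_) β × All (_≢ S) β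

  descent-∷ : RightDescent S r → RightDescent S (x ∷ r)
  descent-∷ {x = x} (α , β , refl , S⌣β , S∉β) = x ∷ α , β , refl , S⌣β , S∉β

  descent-∷⁻ : RightDescent S (x ∷ r) → RightDescent S r ⊎ (x ≡ S × All (S ⌣_) r)
  descent-∷⁻ ([] , β , refl , S⌣β , _) = inj₂ (refl , S⌣β)
  descent-∷⁻ (_ ∷ α , β , eq , rest) = inj₁ (α , β , ∷-injectiveʳ eq , rest)

  commuting-without-descent : ¬ RightDescent S r → All (S ⌣_) r → All (_≢ S) r
  commuting-without-descent _ [] = []
  commuting-without-descent {r = y ∷ r} ¬d (S⌣y ∷ S⌣r) =
    (λ { refl → ¬d ([] , r , refl , S⌣r , S∉r) }) ∷ S∉r
    where S∉r = commuting-without-descent (¬d ∘ descent-∷) S⌣r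

  rightDescent? : ∀ S r → Dec (RightDescent S r)
  rightDescent? S [] = no λ { ([] , _ , () , _) ; (_ ∷ _ , _ , () , _) }
  rightDescent? S (x ∷ r) with rightDescent? S r | x ≟ S | all? (S ⌣?_) r
  ... | yes d  | _        | _        = yes (descent-∷ d)
  ... | no ¬d  | yes refl | yes S⌣r  =
    yes ([] , r , refl , S⌣r , commuting-without-descent ¬d S⌣r)
  ... | no ¬d  | yes _    | no ¬S⌣r  = no ([ ¬d , ¬S⌣r ∘ proj₂ ]′ ∘ descent-∷⁻)
  ... | no ¬d  | no x≢S   | _        = no ([ ¬d , x≢S ∘ proj₁ ]′ ∘ descent-∷⁻)

  infixl 5 _·_
  _·_ : List A → A → List A
  r · S with rightDescent? S r
  ... | yes (α , β , _) = α ++ β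
  ... | no _ = r ∷ʳ S

  EndsWith : A → List A → Set
  EndsWith S l = ∃ λ l′ → l ≡ l′ ∷ʳ S

  descent⇒projections : RightDescent S r → ∀ T → Dependent S T → EndsWith S (project S T r)
  descent⇒projections (α , β , refl , S⌣β , S∉β) T d =
    project _ T (α ++ β) , project-descent α β d (inj₁ refl) S⌣β S∉β

  projections⇒descent : (∀ T → Dependent S T → EndsWith S (project S T r)) → RightDescent S r
  projections⇒descent {S} {r} ends with last-occurrence _≟_ S r
  ... | inj₂ S∉r = contradiction (++-conicalʳ l [ S ] (trans (sym eq) no-S)) λ ()
    where
    l = proj₁ (ends S (inj₁ refl))
    eq = proj₂ (ends S (inj₁ refl))
    not-S : ∀ {y} → y ≢ S → ¬ OneOf S S y
    not-S y≢S = [ y≢S , y≢S ]′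
    no-S = filter-none (oneOf? S S) (All.map not-S S∉r)
  ... | inj₁ (α , β , refl , S∉β) = α , β , refl , All.tabulate commutes , S∉β
    where
    -- a later letter y not commuting with S would end the projection to {S, y}
    commutes : ∀ {y} → y ∈ β → S ⌣ y
    commutes {y} y∈β with S ⌣? y
    ... | yes S⌣y = S⌣y
    ... | no S⌣̸y = ⊥-elim (All.lookup S∉β (proj₁ (∈-filter⁻ (oneOf? S y) S∈)) refl)
      where
      l = proj₁ (ends y (inj₂ S⌣̸y))
      split : project S y (α ++ S ∷ β) ≡ (project S y α ∷ʳ S) ++ project S y β
      split = trans (filter-++ (oneOf? S y) α (S ∷ β))
                (trans (cong (project S y α ++_) (filter-accept (oneOf? S y) (inj₁ refl)))
                       (sym (++-assoc (project S y α) [ S ] (project S y β))))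
      S∈ : S ∈ project S y β
      S∈ = ∷ʳ-last-∈ l (project S y α ∷ʳ S) (∈-filter⁺ (oneOf? S y) y∈β (inj₂ refl))
             (trans (sym (proj₂ (ends y (inj₂ S⌣̸y)))) split)

  AgreeAt : A → List A → List A → Set
  AgreeAt S r r′ = ∀ T → Dependent S T → project S T r ≡ project S T r′

  descent-transport : AgreeAt S r r′ → RightDescent S r → RightDescent S r′
  descent-transport agree desc = projections⇒descent λ T d →
    let (l , eq) = descent⇒projections desc T d in l , trans (sym (agree T d)) eq

  ·-no-descent : ∀ r → ¬ RightDescent S r → r · S ≡ r ∷ʳ S
  ·-no-descent {S} r ¬desc with rightDescent? S r
  ... | yes desc = ⊥-elim (¬desc desc)
  ... | no _ = refl

  ·-outside : ∀ r → ¬ OneOf U V S → project U V (r · S) ≡ project U V r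
  ·-outside {S = S} r S∉ with rightDescent? S r
  ... | yes (α , β , refl , _) = sym (project-delete α β S∉)
  ... | no _ = project-∷ʳ-out r S∉

  ·-inside : ∀ r → Dependent U V → OneOf U V S →
    (RightDescent S r × project U V (r · S) ∷ʳ S ≡ project U V r) ⊎
    (¬ RightDescent S r × project U V (r · S) ≡ project U V r ∷ʳ S)
  ·-inside {S = S} r d S∈ with rightDescent? S r
  ... | yes desc@(α , β , refl , S⌣β , S∉β) =
    inj₁ (desc , sym (project-descent α β d S∈ S⌣β S∉β))
  ... | no ¬desc = inj₂ (¬desc , project-∷ʳ-in r d S∈)

  ·-project : ∀ r r′ → Dependent U V → AgreeAt S r r′ →
    project U V r ≡ project U V r′ → project U V (r · S) ≡ project U V (r′ · S)
  ·-project {U} {V} {S} r r′ d agree eq with oneOf? U V S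
  ... | no S∉ = trans (·-outside r S∉) (trans eq (sym (·-outside r′ S∉)))
  ... | yes S∈ with ·-inside r d S∈ | ·-inside r′ d S∈
  ... | inj₁ (_ , e) | inj₁ (_ , e′) =
    proj₁ (∷ʳ-injective _ _ (trans e (trans eq (sym e′))))
  ... | inj₂ (_ , e) | inj₂ (_ , e′) = trans e (trans (cong (_∷ʳ S) eq) (sym e′))
  ... | inj₁ (desc , _) | inj₂ (¬desc , _) = contradiction (descent-transport agree desc) ¬desc
  ... | inj₂ (¬desc , _) | inj₁ (desc , _) =
    contradiction (descent-transport (λ T d → sym (agree T d)) desc) ¬desc

  ·-cong : r ≃ r′ → r · S ≃ r′ · S
  ·-cong {r} {r′} (mk≃ eq) = mk≃ λ U V d → ·-project r r′ d (λ T → eq _ T) (eq U V d)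

  ·-invisible : ∀ r → S ⌣ T → S ≢ T → AgreeAt S (r · T) r
  ·-invisible r S⌣T S≢T U d =
    ·-outside r (commuting-not-OneOf d (inj₁ refl) S⌣T (S≢T ∘ sym))

  ·-comm : ∀ r → S ⌣ T → S ≢ T → r · S · T ≃ r · T · S
  ·-comm {S} {T} r S⌣T S≢T = mk≃ λ U V d → case U V d (oneOf? U V S) (oneOf? U V T)
    where
    case : ∀ U V → Dependent U V → Dec (OneOf U V S) → Dec (OneOf U V T) →
           project U V (r · S · T) ≡ project U V (r · T · S)
    case U V d (yes S∈) (yes T∈) = ⊥-elim (commuting-not-OneOf d S∈ S⌣T (S≢T ∘ sym) T∈)
    case U V d (no S∉) (no T∉) = begin
      project U V (r · S · T) ≡⟨ ·-outside (r · S) T∉ ⟩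
      project U V (r · S)     ≡⟨ ·-outside r S∉ ⟩
      project U V r           ≡⟨ ·-outside r T∉ ⟨
      project U V (r · T)     ≡⟨ ·-outside (r · T) S∉ ⟨
      project U V (r · T · S) ∎
      where open ≡-Reasoning
    case U V d (yes S∈) (no T∉) = trans (·-outside (r · S) T∉)
      (sym (·-project (r · T) r d (·-invisible r S⌣T S≢T) (·-outside r T∉)))
    case U V d (no S∉) (yes T∈) =
      trans (·-project (r · S) r d (·-invisible r (⌣-sym S⌣T) (S≢T ∘ sym)) (·-outside r S∉))
            (sym (·-outside (r · T) S∉))

  MeetsCopy : A → List A → Set
  MeetsCopy x r = ∃₂ λ γ δ → r ≡ γ ++ x ∷ δ × All (x ⌣_) γ

  Reduced : List A → Set
  Reduced [] = ⊤
  Reduced (x ∷ r) = ¬ MeetsCopy x r × Reduced r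

  Reduced-++⁻ʳ : ∀ α → Reduced (α ++ β) → Reduced β
  Reduced-++⁻ʳ [] red = red
  Reduced-++⁻ʳ (_ ∷ α) (_ , red) = Reduced-++⁻ʳ α red

  Reduced-delete : ∀ α → Reduced (α ++ S ∷ β) → All (S ⌣_) β → Reduced (α ++ β)
  Reduced-delete [] (_ , red) _ = red
  Reduced-delete {S} {β} (x ∷ α) (¬meets , red) S⌣β =
    ¬meets′ , Reduced-delete α red S⌣β
    where
    ¬meets′ : ¬ MeetsCopy x (α ++ β)
    ¬meets′ (γ , δ , eq , x⌣γ) with ++-split α β γ δ eq
    ... | inj₁ (e , refl , refl) =
      ¬meets (γ , e ++ S ∷ β , ++-assoc γ (x ∷ e) (S ∷ β) , x⌣γ)
    ... | inj₂ (e , refl , refl) = ¬meets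
      ( α ++ S ∷ e , δ , sym (++-assoc α (S ∷ e) (x ∷ δ))
      , ++⁺ (++⁻ˡ α x⌣γ) (⌣-sym (All.lookup S⌣β (∈-++⁺ʳ e (here refl))) ∷ ++⁻ʳ α x⌣γ))

  Reduced-∷ʳ : ∀ r → ¬ RightDescent S r → Reduced r → Reduced (r ∷ʳ S)
  Reduced-∷ʳ [] _ _ = (λ { ([] , _ , () , _) ; (_ ∷ _ , _ , () , _) }) , tt
  Reduced-∷ʳ {S} (x ∷ r) ¬desc (¬meets , red) =
    ¬meets′ , Reduced-∷ʳ r (¬desc ∘ descent-∷) red
    where
    ¬meets′ : ¬ MeetsCopy x (r ∷ʳ S)
    ¬meets′ (γ , δ , eq , x⌣γ) with ++-split r [ S ] γ δ eq
    ... | inj₁ (e , r≡ , _) = ¬meets (γ , e , r≡ , x⌣γ)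
    ... | inj₂ (_ ∷ e , _ , S∷[]≡) =
      contradiction (++-conicalʳ e _ (sym (∷-injectiveʳ S∷[]≡))) λ ()
    ... | inj₂ ([] , refl , refl) =
      ¬desc ([] , r , refl , S⌣r , commuting-without-descent (¬desc ∘ descent-∷) S⌣r)
      where S⌣r = subst (All (S ⌣_)) (++-identityʳ r) x⌣γ

  ·-reduced : ∀ r → Reduced r → Reduced (r · S)
  ·-reduced {S} r red with rightDescent? S r
  ... | yes (α , β , refl , S⌣β , _) = Reduced-delete α red S⌣β
  ... | no ¬desc = Reduced-∷ʳ r ¬desc red

  descent-of-∷ʳ : ∀ r → r ∷ʳ S ≡ α ++ S ∷ β → All (_≢ S) β → α ≡ r × β ≡ []
  descent-of-∷ʳ {β = []} r eq _ = sym (proj₁ (∷ʳ-injective r _ eq)) , refl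
  descent-of-∷ʳ {S} {α} {b ∷ β} r eq (b≢S ∷ S∉β)
    with ∷ʳ-last-∈ r (α ∷ʳ S) (here refl) (trans eq (sym (++-assoc α [ S ] (b ∷ β))))
  ... | here S≡b = ⊥-elim (b≢S (sym S≡b))
  ... | there S∈β = ⊥-elim (All.lookup S∉β S∈β refl)

  descent-after-delete : ∀ α → Reduced (α ++ S ∷ β) → All (_≢ S) β →
                         ¬ RightDescent S (α ++ β)
  descent-after-delete {S} {β} α red S∉β (α′ , β′ , eq , S⌣β′ , _) with ++-split α β α′ β′ eq
  ... | inj₂ (e , _ , refl) = All.lookup S∉β (∈-++⁺ʳ e (here refl)) refl
  ... | inj₁ (γ , refl , refl) = proj₁ reduced-from-α′ (γ , β , refl , ++⁻ˡ γ S⌣β′)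
    where
    reduced-from-α′ : Reduced (S ∷ γ ++ S ∷ β)
    reduced-from-α′ = Reduced-++⁻ʳ α′ (subst Reduced (++-assoc α′ (S ∷ γ) (S ∷ β)) red)

  ·-cancel : ∀ r → Reduced r → r · S · S ≃ r
  ·-cancel {S} r red with rightDescent? S r
  ... | no ¬desc with rightDescent? S (r ∷ʳ S)
  ...   | no ¬desc′ = ⊥-elim (¬desc′ (r , [] , refl , [] , []))
  ...   | yes (α , β , eq , _ , S∉β) with descent-of-∷ʳ r eq S∉β
  ...     | refl , refl = mk≃ λ U V _ → cong (project U V) (++-identityʳ α)
  ·-cancel {S} r red | yes (α , β , refl , S⌣β , S∉β) with rightDescent? S (α ++ β)
  ...   | yes desc = ⊥-elim (descent-after-delete α red S∉β desc)
  ...   | no _ = mk≃ restore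
    where
    restore : ∀ U V → Dependent U V → project U V ((α ++ β) ∷ʳ S) ≡ project U V (α ++ S ∷ β)
    restore U V d with oneOf? U V S
    ... | yes S∈ =
      trans (project-∷ʳ-in (α ++ β) d S∈) (sym (project-descent α β d S∈ S⌣β S∉β))
    ... | no S∉ = trans (project-∷ʳ-out (α ++ β) S∉) (sym (project-delete α β S∉))


open import Defs

module Cactus (n : ℕ) where

  open Reflection

  gen-p<q : (g : Gen n) → p g < q g
  gen-p<q (s p q _ p<q _) = recompute (p <? q) p<q

  gen-1≤p : (g : Gen n) → 1 ≤ p g
  gen-1≤p (s p q 1≤p _ _) = recompute (1 ≤? p) 1≤p

  gen-q≤n : (g : Gen n) → q g ≤ n
  gen-q≤n (s p q _ _ q≤n) = recompute (q ≤? n) q≤n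

  gen-≡ : ∀ {a b : Gen n} → p a ≡ p b → q a ≡ q b → a ≡ b
  gen-≡ {s _ _ _ _ _} {s _ _ _ _ _} refl refl = refl

  infix 4 _∈ᵍ_
  _∈ᵍ_ : ℕ → Gen n → Set
  y ∈ᵍ g = y ∈[ p g , q g ]

  ρ : Gen n → ℕ → ℕ
  ρ g = reflect (p g) (q g)

  p∈ᵍ : ∀ g → p g ∈ᵍ g
  p∈ᵍ g = ≤-refl , <⇒≤ (gen-p<q g)

  q∈ᵍ : ∀ g → q g ∈ᵍ g
  q∈ᵍ g = <⇒≤ (gen-p<q g) , ≤-refl

  ∈ᵍ⇒∈[1,n] : ∀ {y} g → y ∈ᵍ g → y ∈[ 1 , n ]
  ∈ᵍ⇒∈[1,n] g (p≤y , y≤q) = ≤-trans (gen-1≤p g) p≤y , ≤-trans y≤q (gen-q≤n g)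

  Inside⇒⊆ : ∀ b a → Inside b a → ∀ {y} → y ∈ᵍ b → y ∈ᵍ a
  Inside⇒⊆ b a (pa≤pb , qb≤qa) (pb≤y , y≤qb) = ≤-trans pa≤pb pb≤y , ≤-trans y≤qb qb≤qa

  ⊆⇒Inside : ∀ b a → (∀ {y} → y ∈ᵍ b → y ∈ᵍ a) → Inside b a
  ⊆⇒Inside b a b⊆a = proj₁ (b⊆a (p∈ᵍ b)) , proj₂ (b⊆a (q∈ᵍ b))

  Disjoint⇒∉ : ∀ a b → Disjoint a b → ∀ {y} → y ∈ᵍ a → ¬ y ∈ᵍ b
  Disjoint⇒∉ a b (inj₁ qa<pb) (_ , y≤qa) (pb≤y , _) = <⇒≱ qa<pb (≤-trans pb≤y y≤qa)
  Disjoint⇒∉ a b (inj₂ qb<pa) (pa≤y , _) (_ , y≤qb) = <⇒≱ qb<pa (≤-trans pa≤y y≤qb)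

  ∉⇒Disjoint : ∀ a b → (∀ {y} → y ∈ᵍ a → ¬ y ∈ᵍ b) → Disjoint a b
  ∉⇒Disjoint a b disjoint with q a <? p b | q b <? p a
  ... | yes qa<pb | _ = inj₁ qa<pb
  ... | no _ | yes qb<pa = inj₂ qb<pa
  ... | no qa≮pb | no qb≮pa with p a ≤? p b
  ...   | yes pa≤pb = ⊥-elim (disjoint (pa≤pb , ≮⇒≥ qa≮pb) (p∈ᵍ b))
  ...   | no pa≰pb = ⊥-elim (disjoint (p∈ᵍ a) (<⇒≤ (≰⇒> pa≰pb) , ≮⇒≥ qb≮pa))

  IntervalsCommute : Gen n → Gen n → Set
  IntervalsCommute a b = Disjoint a b ⊎ Inside a b ⊎ Inside b a

  ρ-preserves-inside : ∀ b a → Inside b a → ∀ y → ρ b y ∈ᵍ a ⇔ y ∈ᵍ a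
  ρ-preserves-inside b a b⊆a = reflect-preserves (_∈ᵍ a) (inj₁ (Inside⇒⊆ b a b⊆a))

  ρ-preserves-disjoint : ∀ b a → Disjoint b a → ∀ y → ρ b y ∈ᵍ a ⇔ y ∈ᵍ a
  ρ-preserves-disjoint b a b∩a = reflect-preserves (_∈ᵍ a) (inj₂ (Disjoint⇒∉ b a b∩a))

  module Flip {a b c : Gen n} (b⊆a : Inside b a) (flip : FlipOf a b c) where

    open Nested (proj₁ b⊆a) (<⇒≤ (gen-p<q b)) (proj₂ b⊆a)

    private
      ∈ᵍ-flip : ∀ y → (y ∈ᵍ c) ≡ (y ∈[ m′ , r′ ])
      ∈ᵍ-flip y = cong₂ (λ u v → y ∈[ u , v ]) (proj₁ flip) (proj₂ flip)

      ρ-flip : ∀ y → ρ c y ≡ reflect m′ r′ y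
      ρ-flip y = cong₂ (λ u v → reflect u v y) (proj₁ flip) (proj₂ flip)

    flip-inside : Inside c a
    flip-inside = ⊆⇒Inside c a λ {y} y∈c → flipped-⊆ (subst id (∈ᵍ-flip y) y∈c)

    ρ-∈-flip : ∀ y → ρ a y ∈ᵍ b ⇔ y ∈ᵍ c
    ρ-∈-flip y = subst (ρ a y ∈ᵍ b ⇔_) (sym (∈ᵍ-flip y)) (reflect-∈-nested y)

    ρ-conjugate : ∀ y → ρ b (ρ a y) ≡ ρ a (ρ c y)
    ρ-conjugate y = trans (reflect-conjugate y) (cong (ρ a) (sym (ρ-flip y)))

  flipped : (a b : Gen n) → Inside b a → Gen n
  flipped a b b⊆a = s (p a + q a ∸ q b) (p a + q a ∸ p b)
    (≤-trans (gen-1≤p a) (proj₁ (mirror-∈ (⊆a (q∈ᵍ b)))))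
    (∸-monoʳ-< (gen-p<q b) (∈[]⇒≤+ (⊆a (q∈ᵍ b))))
    (≤-trans (proj₂ (mirror-∈ (⊆a (p∈ᵍ b)))) (gen-q≤n a))
    where ⊆a = Inside⇒⊆ b a b⊆a

  flipped-involutive : ∀ a b (b⊆a : Inside b a) → FlipOf a (flipped a b b⊆a) b
  flipped-involutive a b b⊆a =
    sym (m∸[m∸n]≡n (∈[]⇒≤+ (⊆a (p∈ᵍ b)))) , sym (m∸[m∸n]≡n (∈[]⇒≤+ (⊆a (q∈ᵍ b))))
    where ⊆a = Inside⇒⊆ b a b⊆a

  move-exists : ∀ a b → IntervalsCommute a b → ∃₂ λ c d → Move a b c d
  move-exists a b (inj₁ a∩b) = b , a , comm a∩b
  move-exists a b (inj₂ (inj₁ a⊆b)) = b , a′ , nestB a′⊆b (flipped-involutive b a a⊆b)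
    where
    a′ = flipped b a a⊆b
    a′⊆b = Flip.flip-inside {b} {a} {a′} a⊆b (refl , refl)
  move-exists a b (inj₂ (inj₂ b⊆a)) = flipped a b b⊆a , a , nestF b⊆a (refl , refl)

  record MoveGeometry (a b c d : Gen n) : Set where
    field
      moved    : ∀ y → ρ a y ∈ᵍ b ⇔ y ∈ᵍ c
      stayed   : ∀ y → ρ c y ∈ᵍ d ⇔ y ∈ᵍ a
      ρ-square : ∀ y → ρ b (ρ a y) ≡ ρ d (ρ c y)
      commute  : IntervalsCommute a c

  moveGeometry : ∀ {a b c d} → Move a b c d → MoveGeometry a b c d
  moveGeometry {a} {b} (comm a∩b) = record
    { moved    = ρ-preserves-disjoint a b a∩b
    ; stayed   = ρ-preserves-disjoint b a (swap a∩b)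
    ; ρ-square = reflect-comm (Disjoint⇒∉ b a (swap a∩b))
    ; commute  = inj₁ a∩b
    }
  moveGeometry {a} {b} {c} (nestF b⊆a flip) = record
    { moved    = ρ-∈-flip
    ; stayed   = ρ-preserves-inside c a flip-inside
    ; ρ-square = ρ-conjugate
    ; commute  = inj₂ (inj₂ flip-inside)
    }
    where open Flip {a} {b} {c} b⊆a flip
  moveGeometry {a} {b} {_} {d} (nestB d⊆b flip) = record
    { moved    = ρ-preserves-inside a b flip-inside
    ; stayed   = ρ-∈-flip
    ; ρ-square = sym ∘ ρ-conjugate
    ; commute  = inj₂ (inj₁ flip-inside)
    }
    where open Flip {b} {d} {a} d⊆b flip

  -- Blocks

  private
    does-true : ∀ {A : Set} (a? : Dec A) → does a? ≡ true → A
    does-true (yes a) _ = a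

  pos : Fin n → ℕ
  pos i = suc (toℕ i)

  block : (ℕ → ℕ) → Gen n → Subset n
  block τ g = tabulate λ i → does (τ (pos i) ∈[ p g , q g ]?)

  ∈-block⁻ : ∀ τ g {i} → i ∈ˢ block τ g → τ (pos i) ∈ᵍ g
  ∈-block⁻ τ g {i} i∈ = does-true (τ (pos i) ∈[ p g , q g ]?)
    (trans (sym (lookup∘tabulate (λ j → does (τ (pos j) ∈[ p g , q g ]?)) i)) ([]=⇒lookup i∈))

  ∈-block⁺ : ∀ τ g {i} → τ (pos i) ∈ᵍ g → i ∈ˢ block τ g
  ∈-block⁺ τ g {i} y∈ = lookup⇒[]= i _
    (trans (lookup∘tabulate (λ j → does (τ (pos j) ∈[ p g , q g ]?)) i)
           (dec-true (τ (pos i) ∈[ p g , q g ]?) y∈))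

  block-cong : ∀ {τ τ′} g → (∀ y → τ y ≡ τ′ y) → block τ g ≡ block τ′ g
  block-cong g eq = tabulate-cong λ i → cong (λ y → does (y ∈[ p g , q g ]?)) (eq (pos i))

  block-ρ : ∀ τ g b c → (∀ y → ρ g y ∈ᵍ b ⇔ y ∈ᵍ c) → block (ρ g ∘ τ) b ≡ block τ c
  block-ρ τ g b c ρ∈ = tabulate-cong λ i →
    does-⇔ (ρ∈ (τ (pos i))) (ρ g (τ (pos i)) ∈[ p b , q b ]?) (τ (pos i) ∈[ p c , q c ]?)

  block-ρ-self : ∀ τ g → block (ρ g ∘ τ) g ≡ block τ g
  block-ρ-self τ g = block-ρ τ g g g (reflect-preserves (_∈ᵍ g) (inj₁ id))

  Onto : (ℕ → ℕ) → Set
  Onto τ = ∀ {y} → y ∈[ 1 , n ] → ∃ λ i → τ (pos i) ≡ y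

  Onto-id : Onto id
  Onto-id {suc k} (_ , k<n) = fromℕ< k<n , cong suc (toℕ-fromℕ< k<n)

  ρ-∈[1,n] : ∀ g {y} → y ∈[ 1 , n ] → ρ g y ∈[ 1 , n ]
  ρ-∈[1,n] g {y} = Equivalence.from (reflect-preserves (_∈[ 1 , n ]) (inj₁ (∈ᵍ⇒∈[1,n] g)) y)

  Onto-ρ : ∀ τ g → Onto τ → Onto (ρ g ∘ τ)
  Onto-ρ τ g onto {y} y∈ with onto (ρ-∈[1,n] g y∈)
  ... | i , eq = i , trans (cong (ρ g) eq) (reflect-involutive (p g) (q g) y)

  preimage : ∀ τ g {y} → Onto τ → y ∈ᵍ g → ∃ λ i → i ∈ˢ block τ g × τ (pos i) ≡ y
  preimage τ g onto y∈ with onto (∈ᵍ⇒∈[1,n] g y∈)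
  ... | i , refl = i , ∈-block⁺ τ g y∈ , refl

  infix 4 _⌣_
  _⌣_ : Subset n → Subset n → Set
  X ⌣ Y = Empty (X ∩ Y) ⊎ X ⊆ Y ⊎ Y ⊆ X

  _⌣?_ : Decidable _⌣_
  X ⌣? Y = ¬? (nonempty? (X ∩ Y)) ⊎-dec X ⊆? Y ⊎-dec Y ⊆? X

  ⌣-sym : Symmetric _⌣_
  ⌣-sym {X} {Y} (inj₁ empty) = inj₁ (empty ∘ subst Nonempty (∩-comm Y X))
  ⌣-sym (inj₂ (inj₁ X⊆Y)) = inj₂ (inj₂ X⊆Y)
  ⌣-sym (inj₂ (inj₂ Y⊆X)) = inj₂ (inj₁ Y⊆X)

  blocks-commute : ∀ τ a b → IntervalsCommute a b → block τ a ⌣ block τ b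
  blocks-commute τ a b (inj₁ a∩b) = inj₁ λ (i , i∈) →
    let (i∈a , i∈b) = x∈p∩q⁻ (block τ a) (block τ b) i∈ in
    Disjoint⇒∉ a b a∩b (∈-block⁻ τ a i∈a) (∈-block⁻ τ b i∈b)
  blocks-commute τ a b (inj₂ (inj₁ a⊆b)) =
    inj₂ (inj₁ (∈-block⁺ τ b ∘ Inside⇒⊆ a b a⊆b ∘ ∈-block⁻ τ a))
  blocks-commute τ a b (inj₂ (inj₂ b⊆a)) =
    inj₂ (inj₂ (∈-block⁺ τ a ∘ Inside⇒⊆ b a b⊆a ∘ ∈-block⁻ τ b))

  block-⊆⇒Inside : ∀ τ a b → Onto τ → block τ a ⊆ block τ b → Inside a b
  block-⊆⇒Inside τ a b onto a⊆b = ⊆⇒Inside a b λ y∈a →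
    let (i , i∈ , τi≡y) = preimage τ a onto y∈a in
    subst (_∈ᵍ b) τi≡y (∈-block⁻ τ b (a⊆b i∈))

  commuting-blocks : ∀ τ a b → Onto τ → block τ a ⌣ block τ b → IntervalsCommute a b
  commuting-blocks τ a b onto (inj₁ empty) = inj₁ (∉⇒Disjoint a b λ y∈a y∈b →
    let (i , i∈ , τi≡y) = preimage τ a onto y∈a in
    empty (i , x∈p∩q⁺ (i∈ , ∈-block⁺ τ b (subst (_∈ᵍ b) (sym τi≡y) y∈b))))
  commuting-blocks τ a b onto (inj₂ (inj₁ a⊆b)) = inj₂ (inj₁ (block-⊆⇒Inside τ a b onto a⊆b))
  commuting-blocks τ a b onto (inj₂ (inj₂ b⊆a)) = inj₂ (inj₂ (block-⊆⇒Inside τ b a onto b⊆a))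

  block-injective : ∀ τ a b → Onto τ → block τ a ≡ block τ b → a ≡ b
  block-injective τ a b onto eq =
    gen-≡ (≤-antisym (proj₁ b⊆a) (proj₁ a⊆b)) (≤-antisym (proj₂ a⊆b) (proj₂ b⊆a))
    where
    a⊆b = block-⊆⇒Inside τ a b onto (subst (block τ a ⊆_) eq id)
    b⊆a = block-⊆⇒Inside τ b a onto (subst (_⊆ block τ a) eq id)

  -- The action on states

  open RightAngledCoxeter (≡-dec Bool._≟_) _⌣_ _⌣?_ ⌣-sym

  State : Set
  State = (ℕ → ℕ) × List (Subset n)

  act : Gen n → State → State
  act g (τ , r) = ρ g ∘ τ , r · block τ g

  run : Word n → State → State
  run [] st = st
  run (g ∷ w) st = run w (act g st)

  start : State
  start = id , []

  infix 4 _≈ˢ_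
  _≈ˢ_ : State → State → Set
  (τ , r) ≈ˢ (τ′ , r′) = (∀ y → τ y ≡ τ′ y) × r ≃ r′

  ≈ˢ-refl : ∀ {st} → st ≈ˢ st
  ≈ˢ-refl = (λ _ → refl) , ≃-refl

  ≈ˢ-sym : ∀ {st st′} → st ≈ˢ st′ → st′ ≈ˢ st
  ≈ˢ-sym (τ≗ , r≃) = sym ∘ τ≗ , ≃-sym r≃

  ≈ˢ-trans : ∀ {st st′ st″} → st ≈ˢ st′ → st′ ≈ˢ st″ → st ≈ˢ st″
  ≈ˢ-trans (τ≗ , r≃) (τ≗′ , r≃′) = (λ y → trans (τ≗ y) (τ≗′ y)) , ≃-trans r≃ r≃′

  act-cong : ∀ g {st st′} → st ≈ˢ st′ → act g st ≈ˢ act g st′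
  act-cong g {τ , r} {τ′ , r′} (τ≗ , r≃) =
    cong (ρ g) ∘ τ≗ , subst (λ X → r · block τ g ≃ r′ · X) (block-cong g τ≗) (·-cong r≃)

  run-cong : ∀ w {st st′} → st ≈ˢ st′ → run w st ≈ˢ run w st′
  run-cong [] eq = eq
  run-cong (g ∷ w) eq = run-cong w (act-cong g eq)

  run-++ : ∀ u v st → run (u ++ v) st ≡ run v (run u st)
  run-++ [] v st = refl
  run-++ (g ∷ u) v st = run-++ u v (act g st)

  run-reduced : ∀ w st → Reduced (proj₂ st) → Reduced (proj₂ (run w st))
  run-reduced [] st red = red
  run-reduced (g ∷ w) (τ , r) red = run-reduced w (act g (τ , r)) (·-reduced r red)

  run-involution : ∀ g st → Reduced (proj₂ st) → run (g ∷ g ∷ []) st ≈ˢ st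
  run-involution g (τ , r) red =
      (λ y → reflect-involutive (p g) (q g) (τ y))
    , subst (λ X → r · block τ g · X ≃ r) (sym (block-ρ-self τ g)) (·-cancel r red)

  run-move : ∀ {a b c d} → Move a b c d → ∀ st → run (a ∷ b ∷ []) st ≈ˢ run (c ∷ d ∷ []) st
  run-move {a} {b} {c} {d} move (τ , r) = ρ-square ∘ τ , same-blocks
    where
    open MoveGeometry (moveGeometry move)
    swapped : r · block τ a · block τ c ≃ r · block τ c · block τ a
    swapped with ≡-dec Bool._≟_ (block τ a) (block τ c)
    ... | yes A≡C = subst (λ X → r · block τ a · X ≃ r · X · block τ a) A≡C ≃-refl
    ... | no A≢C = ·-comm r (blocks-commute τ a c commute) A≢C
    same-blocks : r · block τ a · block (ρ a ∘ τ) b ≃ r · block τ c · block (ρ c ∘ τ) d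
    same-blocks rewrite block-ρ τ a b c moved | block-ρ τ c d a stayed = swapped

  run-relation : ∀ {l r′} → Rel l r′ → ∀ st → Reduced (proj₂ st) → run l st ≈ˢ run r′ st
  run-relation (j1 g) st red = run-involution g st red
  run-relation (j2 {a} {b} a∩b) st _ = run-move {a} {b} {b} {a} (comm a∩b) st
  run-relation (j3 {a} {b} {c} b⊆a flip) st _ = run-move {a} {b} {c} {a} (nestF b⊆a flip) st

  run-RelCtx : ∀ {w w′} → RelCtx w w′ → run w start ≈ˢ run w′ start
  run-RelCtx (ctx u l r′ v rel)
    rewrite run-++ u (l ++ v) start | run-++ u (r′ ++ v) start
          | run-++ l v (run u start) | run-++ r′ v (run u start)
    = run-cong v (run-relation rel (run u start) (run-reduced u start tt))

  run-invariant : ∀ {w w′} → w ≈J w′ → run w start ≈ˢ run w′ start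
  run-invariant ε = ≈ˢ-refl
  run-invariant (fwd rel ◅ rest) = ≈ˢ-trans (run-RelCtx rel) (run-invariant rest)
  run-invariant (bwd rel ◅ rest) = ≈ˢ-trans (≈ˢ-sym (run-RelCtx rel)) (run-invariant rest)

  -- Soundness of the procedure

  move-sound : ∀ {a b c d : Gen n} → Move a b c d → SymClosure Rel (a ∷ b ∷ []) (c ∷ d ∷ [])
  move-sound (comm a∩b) = fwd (j2 a∩b)
  move-sound (nestF b⊆a flip) = fwd (j3 b⊆a flip)
  move-sound (nestB d⊆b flip) = bwd (j3 d⊆b flip)

  in-context : ∀ {l r′ : Word n} → SymClosure Rel l r′ →
               ∀ u v → SymClosure RelCtx (u ++ l ++ v) (u ++ r′ ++ v)
  in-context (fwd rel) u v = fwd (ctx u _ _ v rel)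
  in-context (bwd rel) u v = bwd (ctx u _ _ v rel)

  slide-sound : ∀ {v y x v′} → Slide v y x v′ →
                ∀ (u z : Word n) → (u ++ v ++ y ∷ z) ≈J (u ++ x ∷ v′ ++ z)
  slide-sound here u z = ε
  slide-sound (there {b} {v₀} {y} {y₁} {v₁} slide move) u z =
    subst₂ (_≈J_ {n}) (++-assoc u [ b ] (v₀ ++ y ∷ z)) (++-assoc u [ b ] (y₁ ∷ v₁ ++ z))
           (slide-sound slide (u ++ [ b ]) z)
    ◅◅ in-context (move-sound move) u (v₁ ++ z) ◅ ε

  step-sound : ∀ {w w′ : Word n} → Step w w′ → w ≈J w′
  step-sound (step u x v y z v′ slide) =
    subst₂ (_≈J_ {n}) (++-assoc u [ x ] (v ++ y ∷ z)) (++-assoc u [ x ] (x ∷ v′ ++ z))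
           (slide-sound slide (u ++ [ x ]) z)
    ◅◅ fwd (ctx u (x ∷ x ∷ []) [] (v′ ++ z) (j1 x)) ◅ ε

  steps-sound : ∀ {w w′ : Word n} → Star Step w w′ → w ≈J w′
  steps-sound ε = ε
  steps-sound (first ◅ rest) = step-sound first ◅◅ steps-sound rest

  -- Irreducible words

  after : (ℕ → ℕ) → Word n → ℕ → ℕ
  after τ [] = τ
  after τ (g ∷ w) = after (ρ g ∘ τ) w

  blocks : (ℕ → ℕ) → Word n → List (Subset n)
  blocks τ [] = []
  blocks τ (g ∷ w) = block τ g ∷ blocks (ρ g ∘ τ) w

  after-++ : ∀ τ u v → after τ (u ++ v) ≡ after (after τ u) v
  after-++ τ [] v = refl
  after-++ τ (g ∷ u) v = after-++ (ρ g ∘ τ) u v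

  blocks-∷ʳ : ∀ τ w g → blocks τ (w ∷ʳ g) ≡ blocks τ w ∷ʳ block (after τ w) g
  blocks-∷ʳ τ [] g = refl
  blocks-∷ʳ τ (h ∷ w) g = cong (block τ h ∷_) (blocks-∷ʳ (ρ h ∘ τ) w g)

  blocks-≡[] : ∀ {τ} w → blocks τ w ≡ [] → w ≡ []
  blocks-≡[] [] _ = refl

  Onto-after : ∀ τ w → Onto τ → Onto (after τ w)
  Onto-after τ [] onto = onto
  Onto-after τ (g ∷ w) onto = Onto-after (ρ g ∘ τ) w (Onto-ρ τ g onto)

  record BlockOccurrence (τ : ℕ → ℕ) (w : Word n) (S : Subset n) (β : List (Subset n)) : Set where
    field
      prefix suffix : Word n
      letter : Gen n
      split : w ≡ prefix ++ letter ∷ suffix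
      block-letter : block (after τ prefix) letter ≡ S
      blocks-suffix : blocks (ρ letter ∘ after τ prefix) suffix ≡ β

  blocks-occurrence : ∀ τ w α {S β} → blocks τ w ≡ α ++ S ∷ β → BlockOccurrence τ w S β
  blocks-occurrence τ (g ∷ w) [] eq = record
    { prefix = [] ; suffix = w ; letter = g ; split = refl
    ; block-letter = proj₁ (∷-injective eq) ; blocks-suffix = proj₂ (∷-injective eq) }
  blocks-occurrence τ (g ∷ w) (_ ∷ α) eq = record
    { prefix = g ∷ prefix ; suffix = suffix ; letter = letter ; split = cong (g ∷_) split
    ; block-letter = block-letter ; blocks-suffix = blocks-suffix }
    where open BlockOccurrence (blocks-occurrence (ρ g ∘ τ) w α (proj₂ (∷-injective eq)))

  slide-commuting : ∀ v τ g → Onto τ → All (block (after τ v) g ⌣_) (blocks τ v) →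
    ∃₂ λ x v′ → Slide v g x v′ × block τ x ≡ block (after τ v) g
  slide-commuting [] τ g _ _ = g , [] , here , refl
  slide-commuting (b ∷ v) τ g onto (S⌣b ∷ S⌣v)
    with slide-commuting v (ρ b ∘ τ) g (Onto-ρ τ b onto) S⌣v
  ... | y , v′ , slide , block-y = c , d ∷ v′ , there slide move , block-c
    where
    b⌣y : block (ρ b ∘ τ) b ⌣ block (ρ b ∘ τ) y
    b⌣y = subst₂ _⌣_ (sym (block-ρ-self τ b)) (sym block-y) (⌣-sym S⌣b)
    next : ∃₂ λ c d → Move b y c d
    next = move-exists b y (commuting-blocks (ρ b ∘ τ) b y (Onto-ρ τ b onto) b⌣y)
    c = proj₁ next
    d = proj₁ (proj₂ next)
    move = proj₂ (proj₂ next)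
    block-c : block τ c ≡ block (after (ρ b ∘ τ) v) g
    block-c = trans (sym (block-ρ τ b y c (MoveGeometry.moved (moveGeometry move)))) block-y

  step-++ʳ : ∀ {w w′ : Word n} t → Step w w′ → Step (w ++ t) (w′ ++ t)
  step-++ʳ t (step u x v y z v′ slide) = subst₂ Step
    (sym (trans (++-assoc u (x ∷ v ++ y ∷ z) t) (cong (λ r → u ++ x ∷ r) (++-assoc v (y ∷ z) t))))
    (sym (trans (++-assoc u (v′ ++ z) t) (cong (u ++_) (++-assoc v′ z t))))
    (step u x v y (z ++ t) v′ slide)

  Irreducible-++⁻ˡ : ∀ (u v : Word n) → Irreducible (u ++ v) → Irreducible u
  Irreducible-++⁻ˡ u v irr w′ st = irr (w′ ++ v) (step-++ʳ v st)

  -- The cancelled block belongs to some letter x; g slides back through the letters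
  -- after x, and arrives as x itself because blocks determine generators.
  irreducible-no-descent : ∀ w g → Irreducible (w ∷ʳ g) →
    ¬ RightDescent (block (after id w) g) (blocks id w)
  irreducible-no-descent w g irr (α , β , eq , S⌣β , _) with blocks-occurrence id w α eq
  ... | record { prefix = u ; suffix = v ; letter = x ; split = refl
               ; block-letter = block-x ; blocks-suffix = refl } =
    irr (u ++ v′ ++ []) (subst (λ t → Step t (u ++ v′ ++ [])) (sym (++-assoc u (x ∷ v) [ g ]))
                          (step u x v g [] v′ (subst (λ t → Slide v g t v′) y≡x slide)))
    where
    τ = ρ x ∘ after id u
    after-w : after id (u ++ x ∷ v) ≡ after τ v
    after-w = after-++ id u (x ∷ v)
    onto : Onto τ
    onto = Onto-ρ (after id u) x (Onto-after id u Onto-id)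
    slid = slide-commuting v τ g onto (subst (λ σ → All (block σ g ⌣_) (blocks τ v)) after-w S⌣β)
    y = proj₁ slid
    v′ = proj₁ (proj₂ slid)
    slide = proj₁ (proj₂ (proj₂ slid))
    y≡x : y ≡ x
    y≡x = block-injective τ y x onto (begin
      block τ y                       ≡⟨ proj₂ (proj₂ (proj₂ slid)) ⟩
      block (after τ v) g             ≡⟨ cong (λ σ → block σ g) after-w ⟨
      block (after id (u ++ x ∷ v)) g ≡⟨ block-x ⟨
      block (after id u) x            ≡⟨ block-ρ-self (after id u) x ⟨
      block τ x                       ∎)
      where open ≡-Reasoning

  run-irreducible : ∀ pre v → Irreducible (pre ++ v) →
    proj₂ (run v (after id pre , blocks id pre)) ≡ blocks id (pre ++ v)
  run-irreducible pre [] _ = cong (blocks id) (sym (++-identityʳ pre))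
  run-irreducible pre (g ∷ v) irr = begin
    proj₂ (run v (act g (after id pre , blocks id pre)))
      ≡⟨ cong (proj₂ ∘ run v) act-g ⟩
    proj₂ (run v (after id (pre ∷ʳ g) , blocks id (pre ∷ʳ g)))
      ≡⟨ run-irreducible (pre ∷ʳ g) v irr′ ⟩
    blocks id ((pre ∷ʳ g) ++ v)
      ≡⟨ cong (blocks id) (++-assoc pre [ g ] v) ⟩
    blocks id (pre ++ g ∷ v)
      ∎
    where
    open ≡-Reasoning
    irr′ : Irreducible ((pre ∷ʳ g) ++ v)
    irr′ = subst Irreducible (sym (++-assoc pre [ g ] v)) irr
    no-descent = irreducible-no-descent pre g (Irreducible-++⁻ˡ (pre ∷ʳ g) v irr′)
    act-g : act g (after id pre , blocks id pre) ≡ (after id (pre ∷ʳ g) , blocks id (pre ∷ʳ g))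
    act-g = cong₂ _,_ (sym (after-++ id pre [ g ]))
                      (trans (·-no-descent (blocks id pre) no-descent) (sym (blocks-∷ʳ id pre g)))

  irreducible-trivial : ∀ {w : Word n} → Irreducible w → IsTrivial w → w ≡ []
  irreducible-trivial {w} irr trivial = blocks-≡[] w (≃-[] blocks≃[])
    where
    blocks≃[] : blocks id w ≃ []
    blocks≃[] = subst (_≃ []) (run-irreducible [] w irr) (proj₂ (run-invariant trivial))

proposition2p5 : (n : ℕ) → 2 ≤ n → (w w' : Word n) →
    Star Step w w' → Irreducible w' → (w' ≡ [] ⇔ IsTrivial w)
proposition2p5 n _ w w' steps irr = mk⇔
  (λ { refl → w≈w′ })
  (λ trivial → irreducible-trivial irr
                 (EqClosure.transitive RelCtx (EqClosure.symmetric RelCtx w≈w′) trivial))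
  where
  open Cactus n
  w≈w′ : w ≈J w'
  w≈w′ = steps-sound steps
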